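{- Every graph $G$ with $15$ vertices and $m$ edges, where $m\in\{45,46,47,48\}$, is $3$-compliant.
   Context: All graphs are finite, simple and undirected; $\overline{G}$ denotes the complement of $G$. A minor of $G$ is a graph obtained from $G$ by a sequence of vertex deletions, edge deletions and edge contractions. $\Delta(H)$ is the maximum degree of $H$. A graph $G$ on $n$ vertices is $3$-compliant if $G$ or $\overline{G}$ has a minor $H$ with $\Delta(H)\ge n-3$. -}

module Defs where

open import Data.Bool using (Bool; true; false; _∧_; _∨_; not; if_then_else_)
open import Data.Bool.Properties using (∨-comm)
open import Data.Nat using (ℕ; zero; suc; _+_; _⊔_; _≤_; _∸_; _<ᵇ_)
open import Data.Fin using (Fin; toℕ; punchIn; _≟_)
open import Data.List using (List; map; foldr; allFin)
open import Data.Nat.ListAction using (sum)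
open import Data.Product using (Σ; _×_; _,_)
open import Data.Sum using (_⊎_)
open import Relation.Nullary using (yes; no)
open import Relation.Nullary.Decidable using (⌊_⌋)
open import Relation.Binary.PropositionalEquality using (_≡_; refl; cong₂; sym)

record Graph (n : ℕ) : Set where
  field
    adj  : Fin n → Fin n → Bool
    symm : ∀ i j → adj i j ≡ adj j i
    irr  : ∀ i → adj i i ≡ false
open Graph public

_==_ : ∀ {n} → Fin n → Fin n → Bool
i == j = ⌊ i ≟ j ⌋

mkGraph : ∀ {n} → (Fin n → Fin n → Bool) → Graph n
mkGraph {n} f = record { adj = a ; symm = s ; irr = r }
  where
  a : Fin n → Fin n → Bool
  a i j = not (i == j) ∧ (f i j ∨ f j i)
  s : ∀ i j → a i j ≡ a j i
  s i j with i ≟ j | j ≟ i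
  ... | yes _ | yes _ = refl
  ... | no _  | no _  = ∨-comm (f i j) (f j i)
  ... | yes p | no q  = Data.Empty.⊥-elim (q (sym p))
    where import Data.Empty
  ... | no p  | yes q = Data.Empty.⊥-elim (p (sym q))
    where import Data.Empty
  r : ∀ i → a i i ≡ false
  r i with i ≟ i
  ... | yes _ = refl
  ... | no p  = Data.Empty.⊥-elim (p refl)
    where import Data.Empty

complement : ∀ {n} → Graph n → Graph n
complement G = mkGraph (λ i j → not (adj G i j))

count : ∀ {n} → (Fin n → Bool) → ℕ
count {n} p = sum (map (λ i → if p i then 1 else 0) (allFin n))

edgeCount : ∀ {n} → Graph n → ℕ
edgeCount {n} G =
  sum (map (λ i → count (λ j → (toℕ i <ᵇ toℕ j) ∧ adj G i j)) (allFin n))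

degree : ∀ {n} → Graph n → Fin n → ℕ
degree G v = count (adj G v)

-- maximum degree (0 for the empty graph)
maxDegree : ∀ {n} → Graph n → ℕ
maxDegree {n} G = foldr _⊔_ 0 (map (degree G) (allFin n))

deleteVertex : ∀ {n} → Graph (suc n) → Fin (suc n) → Graph n
deleteVertex G v = record
  { adj  = λ i j → adj G (punchIn v i) (punchIn v j)
  ; symm = λ i j → symm G (punchIn v i) (punchIn v j)
  ; irr  = λ i → irr G (punchIn v i) }

deleteEdge : ∀ {n} → Graph n → Fin n → Fin n → Graph n
deleteEdge G u v = mkGraph (λ i j →
  adj G i j ∧ not (((i == u) ∧ (j == v)) ∨ ((i == v) ∧ (j == u))))

-- contract the edge uv: vertex v is removed and merged into u, which
-- becomes adjacent to all neighbours of u and of v (other than itself).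
contract : ∀ {n} → Graph (suc n) → Fin (suc n) → Fin (suc n) → Graph n
contract G u v = mkGraph (λ i j →
  let i' = punchIn v i ; j' = punchIn v j in
  adj G i' j' ∨ ((i' == u) ∧ adj G v j'))

data Minor {m : ℕ} (G : Graph m) : ∀ {n} → Graph n → Set where
  here  : Minor G G
  delV  : ∀ {n} {H : Graph (suc n)} → Minor G H → (v : Fin (suc n)) →
          Minor G (deleteVertex H v)
  delE  : ∀ {n} {H : Graph n} → Minor G H → (u v : Fin n) →
          adj H u v ≡ true → Minor G (deleteEdge H u v)
  contr : ∀ {n} {H : Graph (suc n)} → Minor G H → (u v : Fin (suc n)) →
          adj H u v ≡ true → Minor G (contract H u v)

HasMinorWithMaxDegree≥ : ∀ {m} → Graph m → ℕ → Set
HasMinorWithMaxDegree≥ G d =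
  Σ ℕ (λ k → Σ (Graph k) (λ H → Minor G H × d ≤ maxDegree H))

ThreeCompliant : ∀ {n} → Graph n → Set
ThreeCompliant {n} G =
  HasMinorWithMaxDegree≥ G (n ∸ 3) ⊎ HasMinorWithMaxDegree≥ (complement G) (n ∸ 3)

{-# OPTIONS --safe #-}
-- Contracting an edge uv such that every vertex other than u, v and one
-- further vertex is adjacent to u or v, or a path uvw such that every other
-- vertex is adjacent to u, v or w, leaves a vertex of degree at least n - 3;
-- this may happen in G or in its complement. Let x have minimum degree d.
-- The degrees sum to at most 96, so d ≤ 6, and if d ≤ 1 the complement has
-- such an edge at x. Otherwise, unless G is 3-compliant, any two neighbours
-- of x are missed by a common non-neighbour of x (else the path through x
-- dominates), and a non-neighbour a of x has a common neighbour with x and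
-- any vertex missing x or a (else the complement has a dominating path).
-- Hence every non-neighbour of x has three neighbours in N(x), every
-- neighbour of x has two, d ≥ 5, and by double counting the neighbours of a
-- vertex of degree at least 2 have degree sum at least 3 * 14 = 42. If d = 5,
-- the ten pairs in N(x) need ten different missing non-neighbours, but there
-- are only nine. If d = 6, the degree sum forces all non-neighbours of x to
-- have degree 6, and some neighbour b of x has degree at least 7; comparing
-- neighbour degree sums shows that b is adjacent to every non-neighbour of x,
-- so the edge xb dominates.

module Submission where

open import Defs
open import Data.Bool using (Bool; true; false; _∧_; _∨_; not; if_then_else_)
open import Data.Bool.Properties using (∧-comm; ∨-zeroʳ) renaming (_≟_ to _≟ᵇ_)
open import Data.Empty using (⊥-elim)
open import Data.Fin using (Fin; zero; suc; _≟_; toℕ; punchIn; punchOut)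
open import Data.Fin.Properties using (any?; sequence; punchIn-injective; punchInᵢ≢i; punchIn-punchOut; toℕ-injective)
open import Data.List using (List; []; _∷_; length; map; tabulate; allFin; foldr)
open import Data.List.Properties using (map-cong)
open import Data.List.Extrema.Nat using (argmin; f[argmin]≤f[xs])
open import Data.List.Relation.Unary.All as All using (All; []; _∷_)
open import Data.List.Relation.Unary.AllPairs using (AllPairs; []; _∷_)
open import Data.List.Relation.Unary.Any using (here; there)
open import Data.List.Membership.Propositional using (_∈_)
open import Data.List.Membership.Propositional.Properties using (∈-map⁺; ∈-allFin)
import Data.Nat.ListAction as ListAction
import Data.Nat as ℕ
open import Data.Nat using (ℕ; zero; suc; _+_; _*_; _∸_; _≤_; _<_; _⊔_; _<ᵇ_; _≤?_; _<?_; z≤n; s≤s; s≤s⁻¹; pred)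
open import Data.Nat.Properties hiding (_≟_)
open import Algebra.Properties.CommutativeMonoid.Sum +-0-commutativeMonoid
  using (sum-syntax; sum-cong-≗; ∑-distrib-+; ∑-comm; sum-replicate-zero)
open import Algebra.Properties.Semiring.Sum +-*-semiring using (*-distribˡ-sum)
open import Data.Product using (∃-syntax; ∃₂; _×_; _,_; proj₁; proj₂)
import Data.Sum
open import Data.Sum using (_⊎_; inj₁; inj₂; reduce)
import Data.Sum.Effectful.Left as Leftbiased
open import Effect.Monad using (RawMonad)
open import Level using (0ℓ)
open import Function using (_∘_)
open import Relation.Binary.PropositionalEquality using (_≡_; _≢_; refl; sym; trans; cong; cong₂; subst; subst₂; module ≡-Reasoning)
open import Relation.Nullary using (Dec; yes; no; ¬_; ¬?; contradiction; _×-dec_)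
open import Relation.Nullary.Decidable using (from-no)
open import Relation.Nullary.Reflects using (ofʸ; ofⁿ)

private
  variable
    n : ℕ
    p q : Fin n → Bool
    f g : Fin n → ℕ

[_] : Bool → ℕ
[ b ] = if b then 1 else 0

∑⟨_⟩_ : (Fin n → Bool) → (Fin n → ℕ) → ℕ
∑⟨ p ⟩ f = ∑[ i < _ ] (if p i then f i else 0)

==-refl : (i : Fin n) → (i == i) ≡ true
==-refl i with i ≟ i
... | yes _   = refl
... | no i≢i = contradiction refl i≢i

==-false : {i j : Fin n} → i ≢ j → (i == j) ≡ false
==-false {i = i} {j} i≢j with i ≟ j
... | yes i≡j = contradiction i≡j i≢j
... | no _    = refl

==-false⁻ : {i j : Fin n} → (i == j) ≡ false → i ≢ j
==-false⁻ {i = i} e refl = contradiction (trans (sym (==-refl i)) e) λ ()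

==-true⁻ : {i j : Fin n} → (i == j) ≡ true → i ≡ j
==-true⁻ {i = i} {j} e with i ≟ j
... | yes i≡j = i≡j

suc-==-suc : (i j : Fin n) → (Fin.suc i == suc j) ≡ (i == j)
suc-==-suc i j with i ≟ j
... | yes _ = refl
... | no _  = refl

∧-true : ∀ {a b} → a ≡ true → b ≡ true → (a ∧ b) ≡ true
∧-true refl b≡true = b≡true

∧-true⁻ : ∀ {a b} → (a ∧ b) ≡ true → a ≡ true × b ≡ true
∧-true⁻ {true} b≡true = refl , b≡true

not-true⁻ : ∀ {a} → not a ≡ true → a ≡ false
not-true⁻ {false} _ = refl

sum-map-tabulate : {A : Set} (h : A → ℕ) (g : Fin n → A) →
                   ListAction.sum (map h (tabulate g)) ≡ ∑[ i < n ] h (g i)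
sum-map-tabulate {zero}  h g = refl
sum-map-tabulate {suc n} h g = cong (h (g zero) +_) (sum-map-tabulate h (g ∘ suc))

count≡∑⟨⟩ : (p : Fin n → Bool) → count p ≡ ∑⟨ p ⟩ (λ _ → 1)
count≡∑⟨⟩ p = sum-map-tabulate (λ i → [ p i ]) (λ i → i)

∑-1 : ∀ n → ∑[ i < n ] 1 ≡ n
∑-1 zero    = refl
∑-1 (suc n) = cong suc (∑-1 n)

∑-mono : (∀ i → f i ≤ g i) → ∑[ i < n ] f i ≤ ∑[ i < n ] g i
∑-mono {zero}  f≤g = z≤n
∑-mono {suc n} f≤g = +-mono-≤ (f≤g zero) (∑-mono (f≤g ∘ suc))

∑-mono-< : (∀ i → f i ≤ g i) → (u : Fin n) → f u < g u → ∑[ i < n ] f i < ∑[ i < n ] g i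
∑-mono-< f≤g zero    fu<gu = +-mono-<-≤ fu<gu (∑-mono (f≤g ∘ suc))
∑-mono-< f≤g (suc u) fu<gu = +-mono-≤-< (f≤g zero) (∑-mono-< (f≤g ∘ suc) u fu<gu)

∑-pick : (u : Fin n) (f : Fin n → ℕ) → ∑[ i < n ] (if i == u then f i else 0) ≡ f u
∑-pick {suc n} zero    f = trans (cong (f zero +_) (sum-replicate-zero n)) (+-identityʳ (f zero))
∑-pick {suc n} (suc u) f =
  trans (sum-cong-≗ λ i → cong (λ b → if b then f (suc i) else 0) (suc-==-suc i u)) (∑-pick u (f ∘ suc))

if-mono : ∀ b {x y} → (b ≡ true → x ≤ y) → (if b then x else 0) ≤ (if b then y else 0)
if-mono true  x≤y = x≤y refl
if-mono false _   = z≤n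

∑⟨⟩-mono : (∀ i → p i ≡ true → f i ≤ g i) → ∑⟨ p ⟩ f ≤ ∑⟨ p ⟩ g
∑⟨⟩-mono {p = p} f≤g = ∑-mono λ i → if-mono (p i) (f≤g i)

∑⟨⟩-mono-< : (∀ i → p i ≡ true → f i ≤ g i) → (u : Fin n) → p u ≡ true → f u < g u →
             ∑⟨ p ⟩ f < ∑⟨ p ⟩ g
∑⟨⟩-mono-< {p = p} {f} {g} f≤g u pu fu<gu =
  ∑-mono-< (λ i → if-mono (p i) (f≤g i)) u
    (subst (λ b → (if b then f u else 0) < (if b then g u else 0)) (sym pu) fu<gu)

∑⟨⟩-const : (p : Fin n → Bool) (c : ℕ) → ∑⟨ p ⟩ (λ _ → c) ≡ c * count p
∑⟨⟩-const {n} p c = begin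
  ∑⟨ p ⟩ (λ _ → c)          ≡⟨ sum-cong-≗ (λ i → scale (p i)) ⟩
  ∑[ i < n ] (c * [ p i ])  ≡⟨ *-distribˡ-sum c (λ i → [ p i ]) ⟨
  c * ∑⟨ p ⟩ (λ _ → 1)       ≡⟨ cong (c *_) (count≡∑⟨⟩ p) ⟨
  c * count p               ∎
  where
  open ≡-Reasoning
  scale : ∀ b → (if b then c else 0) ≡ c * [ b ]
  scale true  = sym (*-identityʳ c)
  scale false = sym (*-zeroʳ c)

∧-swapʳ : ∀ a b c → ((a ∧ b) ∧ c) ≡ ((a ∧ c) ∧ b)
∧-swapʳ true  b c = ∧-comm b c
∧-swapʳ false b c = refl

[]-mono : ∀ {a b} → (a ≡ true → b ≡ true) → [ a ] ≤ [ b ]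
[]-mono {true}  a⇒b rewrite a⇒b refl = ≤-refl
[]-mono {false} _ = z≤n

∑⟨⟩-split : (p q : Fin n → Bool) (f : Fin n → ℕ) →
            ∑⟨ p ⟩ f ≡ ∑⟨ (λ i → p i ∧ q i) ⟩ f + ∑⟨ (λ i → p i ∧ not (q i)) ⟩ f
∑⟨⟩-split p q f = trans (sum-cong-≗ λ i → split (p i) (q i) (f i))
  (∑-distrib-+ (λ i → if p i ∧ q i then f i else 0) (λ i → if p i ∧ not (q i) then f i else 0))
  where
  split : ∀ a b x → (if a then x else 0) ≡ (if a ∧ b then x else 0) + (if a ∧ not b then x else 0)
  split true  true  x = sym (+-identityʳ x)
  split true  false x = refl
  split false b     x = refl

∑⟨⟩-cong : {p q : Fin n → Bool} (f : Fin n → ℕ) → (∀ i → p i ≡ q i) → ∑⟨ p ⟩ f ≡ ∑⟨ q ⟩ f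
∑⟨⟩-cong f p≗q = sum-cong-≗ λ i → cong (λ b → if b then f i else 0) (p≗q i)

∑⟨⟩-+ : (p : Fin n → Bool) (f g : Fin n → ℕ) → ∑⟨ p ⟩ (λ i → f i + g i) ≡ ∑⟨ p ⟩ f + ∑⟨ p ⟩ g
∑⟨⟩-+ p f g = trans (sum-cong-≗ λ i → distribute (p i))
  (∑-distrib-+ (λ i → if p i then f i else 0) (λ i → if p i then g i else 0))
  where
  distribute : ∀ {i} b → (if b then f i + g i else 0) ≡ (if b then f i else 0) + (if b then g i else 0)
  distribute true  = refl
  distribute false = refl

∑⟨⟩-indicator : (p q : Fin n → Bool) → ∑⟨ p ⟩ (λ i → [ q i ]) ≡ count (λ i → p i ∧ q i)
∑⟨⟩-indicator p q = sym (trans (count≡∑⟨⟩ (λ i → p i ∧ q i)) (sum-cong-≗ λ i → restrict (p i) (q i)))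
  where
  restrict : ∀ a b → [ a ∧ b ] ≡ (if a then [ b ] else 0)
  restrict true  b = refl
  restrict false b = refl

count-cong : (∀ i → p i ≡ q i) → count p ≡ count q
count-cong p≗q = cong ListAction.sum (map-cong (λ i → cong [_] (p≗q i)) (allFin _))

count-mono : (∀ i → p i ≡ true → q i ≡ true) → count p ≤ count q
count-mono {p = p} {q} p⇒q =
  subst₂ _≤_ (sym (count≡∑⟨⟩ p)) (sym (count≡∑⟨⟩ q)) (∑-mono λ i → []-mono (p⇒q i))

count-false : count (λ (_ : Fin n) → false) ≡ 0
count-false {n = n} = trans (count≡∑⟨⟩ (λ (_ : Fin n) → false)) (sum-replicate-zero n)

count-split : (p q : Fin n → Bool) →
              count p ≡ count (λ i → p i ∧ q i) + count (λ i → p i ∧ not (q i))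
count-split p q = trans (count≡∑⟨⟩ p) (trans (∑⟨⟩-split p q (λ _ → 1))
  (sym (cong₂ _+_ (count≡∑⟨⟩ (λ i → p i ∧ q i)) (count≡∑⟨⟩ (λ i → p i ∧ not (q i))))))

count-∨ : (p q : Fin n → Bool) → count (λ i → p i ∨ q i) ≤ count p + count q
count-∨ p q = subst₂ _≤_ (sym (count≡∑⟨⟩ (λ i → p i ∨ q i))) (sym (cong₂ _+_ (count≡∑⟨⟩ p) (count≡∑⟨⟩ q)))
  (≤-trans (∑-mono λ i → union (p i) (q i)) (≤-reflexive (∑-distrib-+ (λ i → [ p i ]) (λ i → [ q i ]))))
  where
  union : ∀ a b → [ a ∨ b ] ≤ [ a ] + [ b ]
  union true  b = s≤s z≤n
  union false b = ≤-refl

n≤count+count : {p q : Fin n → Bool} → (∀ i → p i ≡ false → q i ≡ true) → n ≤ count p + count q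
n≤count+count {n} {p} {q} ¬p⇒q = subst₂ _≤_ (∑-1 n) (sym (cong₂ _+_ (count≡∑⟨⟩ p) (count≡∑⟨⟩ q)))
  (≤-trans (∑-mono λ i → covered i (p i) refl) (≤-reflexive (∑-distrib-+ (λ i → [ p i ]) (λ i → [ q i ]))))
  where
  covered : ∀ i b → p i ≡ b → 1 ≤ [ b ] + [ q i ]
  covered i true  _  = s≤s z≤n
  covered i false pi rewrite ¬p⇒q i pi = ≤-refl

count-== : (u : Fin n) → count (_== u) ≡ 1
count-== u = trans (count≡∑⟨⟩ (_== u)) (∑-pick u (λ _ → 1))

count-remove : (p : Fin n → Bool) {u : Fin n} → p u ≡ true →
               count p ≡ suc (count (λ i → p i ∧ not (i == u)))
count-remove p {u} pu = trans (count-split p (_== u))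
  (cong (_+ count (λ i → p i ∧ not (i == u))) (trans (count-cong λ i → ∧-comm (p i) (i == u))
    (trans (count≡∑⟨⟩ (λ i → (i == u) ∧ p i)) (trans (sum-cong-≗ λ i → guard (i == u) (p i))
      (trans (∑-pick u (λ i → [ p i ])) (cong [_] pu))))))
  where
  guard : ∀ a b → [ a ∧ b ] ≡ (if a then [ b ] else 0)
  guard true  b = refl
  guard false b = refl

length≤count : (xs : List (Fin n)) → AllPairs _≢_ xs → All (λ i → p i ≡ true) xs → length xs ≤ count p
length≤count [] _ _ = z≤n
length≤count {p = p} (u ∷ xs) (u≢xs ∷ distinct) (pu ∷ pxs) =
  subst (suc (length xs) ≤_) (sym (count-remove p pu))
    (s≤s (length≤count xs distinct (All.zipWith keep (u≢xs , pxs))))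
  where
  keep : ∀ {i} → u ≢ i × p i ≡ true → (p i ∧ not (i == u)) ≡ true
  keep (u≢i , pi) rewrite pi | ==-false (u≢i ∘ sym) = refl

count-witness : {p : Fin n → Bool} → 0 < count p → ∃[ i ] p i ≡ true
count-witness {n = n} {p = p} 0<count with any? (λ i → p i ≟ᵇ true)
... | yes found = found
... | no none = contradiction
  (≤-trans 0<count (subst (count p ≤_) (count-false {n = n}) (count-mono λ i pi → ⊥-elim (none (i , pi)))))
  λ ()

two-distinct : 2 ≤ count p → ∃₂ λ i j → i ≢ j × p i ≡ true × p j ≡ true
two-distinct {p = p} 2≤count with count-witness (≤-trans (s≤s z≤n) 2≤count)
... | i , pi with count-witness (s≤s⁻¹ (subst (2 ≤_) (count-remove p pi) 2≤count))
...   | j , e with ∧-true⁻ e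
...     | pj , j≢i = i , j , (λ i≡j → ==-false⁻ (not-true⁻ j≢i) (sym i≡j)) , pi , pj

count≤1 : {p : Fin n → Bool} → (∀ i j → p i ≡ true → p j ≡ true → i ≡ j) → count p ≤ 1
count≤1 {p = p} unique with count p ≤? 1
... | yes count≤1 = count≤1
... | no count≰1 with two-distinct (≰⇒> count≰1)
...   | i , j , i≢j , pi , pj = contradiction (unique i j pi pj) i≢j

atMostOne : {p : Fin n → Bool} → count p ≤ 1 → Fin n → ∃[ z ] ∀ i → p i ≡ true → i ≡ z
atMostOne {p = p} count≤1 default with any? (λ i → p i ≟ᵇ true)
... | no none = default , λ i pi → ⊥-elim (none (i , pi))
... | yes (z , pz) = z , unique
  where
  unique : ∀ i → p i ≡ true → i ≡ z
  unique i pi with i ≟ z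
  ... | yes i≡z = i≡z
  ... | no i≢z  = contradiction
    (≤-trans (length≤count (i ∷ z ∷ []) ((i≢z ∷ []) ∷ [] ∷ []) (pi ∷ pz ∷ [])) count≤1)
    λ { (s≤s ()) }

∑⟨⟩-count : (p : Fin n → Bool) (R : Fin n → Fin n → Bool) →
            ∑⟨ p ⟩ (λ u → count (R u)) ≡ ∑[ u < n ] ∑[ v < n ] (if p u then [ R u v ] else 0)
∑⟨⟩-count {n} p R = sum-cong-≗ λ u → distribute (p u) (R u)
  where
  distribute : ∀ b (r : Fin n → Bool) → (if b then count r else 0) ≡ ∑[ v < n ] (if b then [ r v ] else 0)
  distribute true  r = count≡∑⟨⟩ r
  distribute false r = sym (sum-replicate-zero n)

∑⟨⟩-count-swap : (p q : Fin n → Bool) (R : Fin n → Fin n → Bool) →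
                 ∑⟨ p ⟩ (λ u → count (λ v → q v ∧ R v u)) ≡ ∑⟨ q ⟩ (λ v → count (λ u → p u ∧ R v u))
∑⟨⟩-count-swap {n} p q R = begin
  ∑⟨ p ⟩ (λ u → count (λ v → q v ∧ R v u))
    ≡⟨ ∑⟨⟩-count p (λ u v → q v ∧ R v u) ⟩
  ∑[ u < n ] ∑[ v < n ] (if p u then [ q v ∧ R v u ] else 0)
    ≡⟨ sum-cong-≗ (λ u → sum-cong-≗ λ v → exchange (p u) (q v) (R v u)) ⟩
  ∑[ u < n ] ∑[ v < n ] (if q v then [ p u ∧ R v u ] else 0)
    ≡⟨ ∑-comm (λ u v → if q v then [ p u ∧ R v u ] else 0) ⟩
  ∑[ v < n ] ∑[ u < n ] (if q v then [ p u ∧ R v u ] else 0)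
    ≡⟨ ∑⟨⟩-count q (λ v u → p u ∧ R v u) ⟨
  ∑⟨ q ⟩ (λ v → count (λ u → p u ∧ R v u)) ∎
  where
  open ≡-Reasoning
  exchange : ∀ a b r → (if a then [ b ∧ r ] else 0) ≡ (if b then [ a ∧ r ] else 0)
  exchange true  true  r = refl
  exchange true  false r = refl
  exchange false true  r = refl
  exchange false false r = refl

count-≤-cover : {p q : Fin n → Bool} (R : Fin n → Fin n → Bool) →
                (∀ v → p v ≡ true → ∃[ a ] (q a ≡ true × R a v ≡ true)) →
                (∀ a → q a ≡ true → count (λ v → p v ∧ R a v) ≤ 1) →
                count p ≤ count q
count-≤-cover {p = p} {q} R covered sparse = begin
  count p                                   ≡⟨ count≡∑⟨⟩ p ⟩
  ∑⟨ p ⟩ (λ _ → 1)                          ≤⟨ ∑⟨⟩-mono witnessed ⟩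
  ∑⟨ p ⟩ (λ v → count (λ a → q a ∧ R a v))  ≡⟨ ∑⟨⟩-count-swap p q R ⟩
  ∑⟨ q ⟩ (λ a → count (λ v → p v ∧ R a v))  ≤⟨ ∑⟨⟩-mono sparse ⟩
  ∑⟨ q ⟩ (λ _ → 1)                          ≡⟨ count≡∑⟨⟩ q ⟨
  count q                                   ∎
  where
  open ≤-Reasoning
  witnessed : ∀ v → p v ≡ true → 1 ≤ count (λ a → q a ∧ R a v)
  witnessed v pv with covered v pv
  ... | a , qa , Rav = length≤count (a ∷ []) ([] ∷ []) (∧-true qa Rav ∷ [])

pairCover-bound : {p q : Fin n → Bool} (R : Fin n → Fin n → Bool) →
                  (∀ a → q a ≡ true → count (λ v → p v ∧ R a v) ≤ 2) →
                  (∀ u v → p u ≡ true → p v ≡ true → u ≢ v →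
                     ∃[ a ] (q a ≡ true × R a u ≡ true × R a v ≡ true)) →
                  count p * pred (count p) ≤ 2 * count q
pairCover-bound {p = p} {q} R misses≤2 covered = begin
  count p * pred (count p)                  ≡⟨ *-comm (count p) (pred (count p)) ⟩
  pred (count p) * count p                  ≡⟨ ∑⟨⟩-const p (pred (count p)) ⟨
  ∑⟨ p ⟩ (λ _ → pred (count p))             ≤⟨ ∑⟨⟩-mono missedBy ⟩
  ∑⟨ p ⟩ (λ u → count (λ a → q a ∧ R a u))  ≡⟨ ∑⟨⟩-count-swap p q R ⟩
  ∑⟨ q ⟩ (λ a → count (λ v → p v ∧ R a v))  ≤⟨ ∑⟨⟩-mono misses≤2 ⟩
  ∑⟨ q ⟩ (λ _ → 2)                          ≡⟨ ∑⟨⟩-const q 2 ⟩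
  2 * count q                               ∎
  where
  open ≤-Reasoning
  missedBy : ∀ u → p u ≡ true → pred (count p) ≤ count (λ a → q a ∧ R a u)
  missedBy u pu = subst (_≤ count (λ a → q a ∧ R a u)) (cong pred (sym (count-remove p pu)))
    (count-≤-cover R cover sparse)
    where
    cover : ∀ v → (p v ∧ not (v == u)) ≡ true → ∃[ a ] ((q a ∧ R a u) ≡ true × R a v ≡ true)
    cover v e with ∧-true⁻ e
    ... | pv , v≢u with covered u v pu pv (λ u≡v → ==-false⁻ (not-true⁻ v≢u) (sym u≡v))
    ...   | a , qa , Rau , Rav = a , ∧-true qa Rau , Rav
    sparse : ∀ a → (q a ∧ R a u) ≡ true → count (λ v → (p v ∧ not (v == u)) ∧ R a v) ≤ 1
    sparse a e with ∧-true⁻ e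
    ... | qa , Rau = s≤s⁻¹ (begin
      suc (count (λ v → (p v ∧ not (v == u)) ∧ R a v))
        ≡⟨ cong suc (count-cong λ v → ∧-swapʳ (p v) (not (v == u)) (R a v)) ⟩
      suc (count (λ v → (p v ∧ R a v) ∧ not (v == u)))
        ≡⟨ count-remove (λ v → p v ∧ R a v) (∧-true pu Rau) ⟨
      count (λ v → p v ∧ R a v)
        ≤⟨ misses≤2 a qa ⟩
      2 ∎)

≤-foldr-⊔ : {xs : List ℕ} {x : ℕ} → x ∈ xs → x ≤ foldr _⊔_ 0 xs
≤-foldr-⊔ {x ∷ _}  (here refl)   = m≤m⊔n x _
≤-foldr-⊔ {y ∷ _}  (there x∈xs) = ≤-trans (≤-foldr-⊔ x∈xs) (m≤n⊔m y _)

degree≤maxDegree : (G : Graph n) (v : Fin n) → degree G v ≤ maxDegree G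
degree≤maxDegree G v = ≤-foldr-⊔ (∈-map⁺ (degree G) (∈-allFin v))

minimumDegreeVertex : (G : Graph (suc n)) → ∃[ x ] ∀ v → degree G x ≤ degree G v
minimumDegreeVertex {n} G = argmin (degree G) zero (allFin (suc n)) ,
  λ v → All.lookup (f[argmin]≤f[xs] {f = degree G} zero (allFin (suc n))) (∈-allFin v)

adj⇒≢ : (G : Graph n) {i j : Fin n} → adj G i j ≡ true → i ≢ j
adj⇒≢ G {i} e refl = contradiction (trans (sym e) (irr G i)) λ ()

handshake : (G : Graph n) → ∑[ v < n ] degree G v ≡ edgeCount G + edgeCount G
handshake {n} G = begin
  ∑[ i < n ] degree G i
    ≡⟨ sum-cong-≗ (λ i → count≡∑⟨⟩ (adj G i)) ⟩
  ∑[ i < n ] ∑[ j < n ] [ adj G i j ]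
    ≡⟨ sum-cong-≗ (λ i → trans (sum-cong-≗ (orient i)) (∑-distrib-+ (forward i) (λ j → backward j i))) ⟩
  ∑[ i < n ] (∑[ j < n ] forward i j + ∑[ j < n ] backward j i)
    ≡⟨ ∑-distrib-+ (λ i → ∑[ j < n ] forward i j) (λ i → ∑[ j < n ] backward j i) ⟩
  E + ∑[ i < n ] ∑[ j < n ] backward j i
    ≡⟨ cong (E +_) (∑-comm (λ i j → backward j i)) ⟩
  E + E
    ≡⟨ cong₂ _+_ edgeCount≡E edgeCount≡E ⟨
  edgeCount G + edgeCount G ∎
  where
  open ≡-Reasoning
  forward backward : Fin n → Fin n → ℕ
  forward  i j = [ (toℕ i <ᵇ toℕ j) ∧ adj G i j ]
  backward j i = [ (toℕ j <ᵇ toℕ i) ∧ adj G j i ]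
  E : ℕ
  E = ∑[ i < n ] ∑[ j < n ] forward i j
  edgeCount≡E : edgeCount G ≡ E
  edgeCount≡E = trans (sum-map-tabulate (λ i → count (λ j → (toℕ i <ᵇ toℕ j) ∧ adj G i j)) (λ i → i))
                      (sum-cong-≗ λ i → count≡∑⟨⟩ (λ j → (toℕ i <ᵇ toℕ j) ∧ adj G i j))
  orient : ∀ i j → [ adj G i j ] ≡ forward i j + backward j i
  orient i j with toℕ i <ᵇ toℕ j | <ᵇ-reflects-< (toℕ i) (toℕ j)
                | toℕ j <ᵇ toℕ i | <ᵇ-reflects-< (toℕ j) (toℕ i)
  ... | true  | ofʸ i<j  | true  | ofʸ j<i  = contradiction j<i (<-asym i<j)
  ... | true  | _        | false | _        = sym (+-identityʳ _)
  ... | false | _        | true  | _        = cong [_] (symm G i j)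
  ... | false | ofⁿ i≮j | false | ofⁿ j≮i =
    cong [_] (subst (λ k → adj G i k ≡ false) (toℕ-injective (≤-antisym (≮⇒≥ j≮i) (≮⇒≥ i≮j))) (irr G i))

hasMinor : {m k : ℕ} {G : Graph m} {K : Graph k} {d : ℕ} →
           Minor G K → (c : Fin k) → d ≤ degree K c → HasMinorWithMaxDegree≥ G d
hasMinor {K = K} G≽K c d≤deg = _ , K , G≽K , ≤-trans d≤deg (degree≤maxDegree K c)

punchIn≢ : {v x : Fin (suc n)} (v≢x : v ≢ x) {j : Fin n} → j ≢ punchOut v≢x → punchIn v j ≢ x
punchIn≢ {v = v} v≢x {j} j≢ eq = j≢ (punchIn-injective v j _ (trans eq (sym (punchIn-punchOut v≢x))))

-- In contract K u v the vertex j is the old punchIn v j, and u itself is punchOut v≢u.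
module _ (K : Graph (suc n)) {u v : Fin (suc n)} where

  contract-adj : {i j : Fin n} → i ≢ j → adj K (punchIn v i) (punchIn v j) ≡ true →
                 adj (contract K u v) i j ≡ true
  contract-adj i≢j e rewrite ==-false i≢j | e = refl

  merged-adj : (v≢u : v ≢ u) {j : Fin n} → punchOut v≢u ≢ j →
               adj K u (punchIn v j) ≡ true ⊎ adj K v (punchIn v j) ≡ true →
               adj (contract K u v) (punchOut v≢u) j ≡ true
  merged-adj v≢u c≢j (inj₁ e) =
    contract-adj c≢j (subst (λ w → adj K w (punchIn v _) ≡ true) (sym (punchIn-punchOut v≢u)) e)
  merged-adj v≢u {j} c≢j (inj₂ e)
    rewrite ==-false c≢j | punchIn-punchOut v≢u | ==-refl u | e | ∨-zeroʳ (adj K u (punchIn v j)) = refl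

  merged-degree : (v≢u : v ≢ u) (E : Fin n → Bool) →
                  (∀ j → j ≢ punchOut v≢u → E j ≡ false →
                     adj K u (punchIn v j) ≡ true ⊎ adj K v (punchIn v j) ≡ true) →
                  n ≤ suc (count E + degree (contract K u v) (punchOut v≢u))
  merged-degree v≢u E dominated = begin
    n                                                ≤⟨ n≤count+count adjacent ⟩
    count (λ j → (j == c) ∨ E j) + degree K′ c       ≤⟨ +-monoˡ-≤ (degree K′ c) (count-∨ (_== c) E) ⟩
    count (_== c) + count E + degree K′ c            ≡⟨ cong (λ k → k + count E + degree K′ c) (count-== c) ⟩
    suc (count E + degree K′ c)                      ∎
    where
    open ≤-Reasoning
    K′ : Graph n
    K′ = contract K u v
    c : Fin n
    c = punchOut v≢u
    adjacent : ∀ j → ((j == c) ∨ E j) ≡ false → adj K′ c j ≡ true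
    adjacent j e with j ≟ c
    adjacent j () | yes _
    ... | no j≢c = merged-adj v≢u (j≢c ∘ sym) (dominated j j≢c e)

dominatingEdge⇒minor : (K : Graph (suc n)) {u v z : Fin (suc n)} → adj K u v ≡ true →
                       (∀ t → t ≢ u → t ≢ v → t ≢ z → adj K u t ≡ true ⊎ adj K v t ≡ true) →
                       HasMinorWithMaxDegree≥ K (suc n ∸ 3)
dominatingEdge⇒minor {n} K {u} {v} {z} uv dominated =
  hasMinor (contr here u v uv) c (m≤n+o⇒m∸n≤o n 2 bound)
  where
  v≢u : v ≢ u
  v≢u = adj⇒≢ K uv ∘ sym
  c : Fin n
  c = punchOut v≢u
  preimage-z : ∀ i j → (punchIn v i == z) ≡ true → (punchIn v j == z) ≡ true → i ≡ j
  preimage-z i j ei ej = punchIn-injective v i j (trans (==-true⁻ ei) (sym (==-true⁻ ej)))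
  bound : n ≤ 2 + degree (contract K u v) c
  bound = ≤-trans (merged-degree K v≢u (λ j → punchIn v j == z)
                     (λ j j≢c e → dominated (punchIn v j) (punchIn≢ v≢u j≢c) (punchInᵢ≢i v j) (==-false⁻ e)))
                  (s≤s (+-monoˡ-≤ _ (count≤1 preimage-z)))

dominatingPath⇒minor : (K : Graph (suc (suc n))) {u v w : Fin (suc (suc n))} →
                       adj K u v ≡ true → adj K u w ≡ true ⊎ adj K v w ≡ true → w ≢ u → w ≢ v →
                       (∀ t → t ≢ u → t ≢ v → t ≢ w →
                          adj K u t ≡ true ⊎ adj K v t ≡ true ⊎ adj K w t ≡ true) →
                       HasMinorWithMaxDegree≥ K (suc (suc n) ∸ 3)
dominatingPath⇒minor {n} K {u} {v} {w} uv uw⊎vw w≢u w≢v dominated =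
  hasMinor (contr (contr here u v uv) c₁ w₁ c₁w₁) c₂ (m≤n+o⇒m∸n≤o n 1 bound)
  where
  v≢u : v ≢ u
  v≢u = adj⇒≢ K uv ∘ sym
  v≢w : v ≢ w
  v≢w = w≢v ∘ sym
  K₁ : Graph (suc n)
  K₁ = contract K u v
  c₁ w₁ : Fin (suc n)
  c₁ = punchOut v≢u
  w₁ = punchOut v≢w
  c₁≢w₁ : c₁ ≢ w₁
  c₁≢w₁ eq = w≢u (trans (sym (punchIn-punchOut v≢w))
                   (trans (cong (punchIn v) (sym eq)) (punchIn-punchOut v≢u)))
  c₁w₁ : adj K₁ c₁ w₁ ≡ true
  c₁w₁ = merged-adj K v≢u c₁≢w₁
    (subst (λ t → adj K u t ≡ true ⊎ adj K v t ≡ true) (sym (punchIn-punchOut v≢w)) uw⊎vw)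
  w₁≢c₁ : w₁ ≢ c₁
  w₁≢c₁ = c₁≢w₁ ∘ sym
  c₂ : Fin n
  c₂ = punchOut w₁≢c₁
  dominated₁ : ∀ j → j ≢ c₁ → j ≢ w₁ → adj K₁ c₁ j ≡ true ⊎ adj K₁ w₁ j ≡ true
  dominated₁ j j≢c₁ j≢w₁ with dominated (punchIn v j) (punchIn≢ v≢u j≢c₁) (punchInᵢ≢i v j) (punchIn≢ v≢w j≢w₁)
  ... | inj₁ ut        = inj₁ (merged-adj K v≢u (j≢c₁ ∘ sym) (inj₁ ut))
  ... | inj₂ (inj₁ vt) = inj₁ (merged-adj K v≢u (j≢c₁ ∘ sym) (inj₂ vt))
  ... | inj₂ (inj₂ wt) = inj₂ (contract-adj K (j≢w₁ ∘ sym)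
                           (subst (λ s → adj K s (punchIn v j) ≡ true) (sym (punchIn-punchOut v≢w)) wt))
  bound : n ≤ 1 + degree (contract K₁ c₁ w₁) c₂
  bound = subst (λ k → n ≤ suc (k + degree (contract K₁ c₁ w₁) c₂)) (count-false {n = n})
            (merged-degree K₁ w₁≢c₁ (λ _ → false)
              (λ j j≢c₂ _ → dominated₁ (punchIn w₁ j) (punchIn≢ w₁≢c₁ j≢c₂) (punchInᵢ≢i w₁ j)))

nonNeighbour : Graph n → Fin n → Fin n → Bool
nonNeighbour G x v = not (adj G x v) ∧ not (v == x)

∑-split-at : (G : Graph n) (x : Fin n) (f : Fin n → ℕ) →
           ∑[ v < n ] f v ≡ f x + (∑⟨ adj G x ⟩ f + ∑⟨ nonNeighbour G x ⟩ f)
∑-split-at {n} G x f = begin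
  ∑[ v < n ] f v
    ≡⟨ sum-cong-≗ trichotomy ⟩
  ∑[ v < n ] (atX v + (inN v + inA v))
    ≡⟨ ∑-distrib-+ atX (λ v → inN v + inA v) ⟩
  ∑[ v < n ] atX v + ∑[ v < n ] (inN v + inA v)
    ≡⟨ cong₂ _+_ (∑-pick x f) (∑-distrib-+ inN inA) ⟩
  f x + (∑⟨ adj G x ⟩ f + ∑⟨ nonNeighbour G x ⟩ f) ∎
  where
  open ≡-Reasoning
  atX inN inA : Fin n → ℕ
  atX v = if v == x then f v else 0
  inN v = if adj G x v then f v else 0
  inA v = if nonNeighbour G x v then f v else 0
  trichotomy : ∀ v → f v ≡ atX v + (inN v + inA v)
  trichotomy v with v ≟ x
  ... | yes refl rewrite irr G v = sym (+-identityʳ (f v))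
  ... | no _ with adj G x v
  ...   | true  = sym (+-identityʳ (f v))
  ...   | false = refl

order-split-at : (G : Graph n) (x : Fin n) → suc (degree G x + count (nonNeighbour G x)) ≡ n
order-split-at {n} G x = begin
  suc (degree G x + count (nonNeighbour G x))
    ≡⟨ cong suc (cong₂ _+_ (count≡∑⟨⟩ (adj G x)) (count≡∑⟨⟩ (nonNeighbour G x))) ⟩
  suc (∑⟨ adj G x ⟩ (λ _ → 1) + ∑⟨ nonNeighbour G x ⟩ (λ _ → 1))
    ≡⟨ ∑-split-at G x (λ _ → 1) ⟨
  ∑[ v < n ] 1
    ≡⟨ ∑-1 n ⟩
  n ∎
  where open ≡-Reasoning

degree-split-at : (G : Graph n) (x b : Fin n) →
                degree G b ≡ [ adj G b x ] + (count (λ v → adj G x v ∧ adj G b v)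
                                              + count (λ v → nonNeighbour G x v ∧ adj G b v))
degree-split-at G x b = trans (count≡∑⟨⟩ (adj G b)) (trans (∑-split-at G x (λ v → [ adj G b v ]))
  (cong ([ adj G b x ] +_) (cong₂ _+_ (∑⟨⟩-indicator (adj G x) (adj G b))
                                       (∑⟨⟩-indicator (nonNeighbour G x) (adj G b)))))

neighbourDegreeSum : Graph n → Fin n → ℕ
neighbourDegreeSum G x = ∑⟨ adj G x ⟩ (degree G)

neighbourDegreeSum-≥ : (G : Graph n) (x : Fin n) →
                       (∀ b → adj G x b ≡ true → 2 ≤ count (λ v → adj G x v ∧ adj G b v)) →
                       (∀ a → nonNeighbour G x a ≡ true → 3 ≤ count (λ v → adj G x v ∧ adj G a v)) →
                       3 * pred n ≤ neighbourDegreeSum G x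
neighbourDegreeSum-≥ {n} G x sees2 sees3 = begin
  3 * pred n
    ≡⟨ cong (λ k → 3 * pred k) (order-split-at G x) ⟨
  3 * (degree G x + count A)
    ≡⟨ *-distribˡ-+ 3 (degree G x) (count A) ⟩
  3 * degree G x + 3 * count A
    ≡⟨ cong₂ _+_ (∑⟨⟩-const N 3) (∑⟨⟩-const A 3) ⟨
  ∑⟨ N ⟩ (λ _ → 3) + ∑⟨ A ⟩ (λ _ → 3)
    ≤⟨ +-monoʳ-≤ (∑⟨ N ⟩ (λ _ → 3)) (∑⟨⟩-mono sees3) ⟩
  ∑⟨ N ⟩ (λ _ → 3) + ∑⟨ A ⟩ (λ a → count (λ v → N v ∧ adj G a v))
    ≡⟨ cong (∑⟨ N ⟩ (λ _ → 3) +_) crossEdges ⟩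
  ∑⟨ N ⟩ (λ _ → 3) + ∑⟨ N ⟩ (λ b → count (λ v → A v ∧ adj G b v))
    ≡⟨ ∑⟨⟩-+ N (λ _ → 3) (λ b → count (λ v → A v ∧ adj G b v)) ⟨
  ∑⟨ N ⟩ (λ b → 3 + count (λ v → A v ∧ adj G b v))
    ≤⟨ ∑⟨⟩-mono degreeBound ⟩
  neighbourDegreeSum G x ∎
  where
  open ≤-Reasoning
  N A : Fin n → Bool
  N = adj G x
  A = nonNeighbour G x
  crossEdges : ∑⟨ A ⟩ (λ a → count (λ v → N v ∧ adj G a v)) ≡ ∑⟨ N ⟩ (λ b → count (λ v → A v ∧ adj G b v))
  crossEdges = trans (∑⟨⟩-count-swap A N (λ v u → adj G u v))
    (sum-cong-≗ λ b → cong (λ k → if N b then k else 0) (count-cong λ v → cong (A v ∧_) (symm G v b)))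
  degreeBound : ∀ b → N b ≡ true → 3 + count (λ v → A v ∧ adj G b v) ≤ degree G b
  degreeBound b xb = begin
    3 + count (λ v → A v ∧ adj G b v)
      ≤⟨ s≤s (+-monoˡ-≤ (count (λ v → A v ∧ adj G b v)) (sees2 b xb)) ⟩
    [ true ] + (count (λ v → N v ∧ adj G b v) + count (λ v → A v ∧ adj G b v))
      ≡⟨ cong (λ e → [ e ] + (count (λ v → N v ∧ adj G b v) + count (λ v → A v ∧ adj G b v)))
              (trans (symm G b x) xb) ⟨
    [ adj G b x ] + (count (λ v → N v ∧ adj G b v) + count (λ v → A v ∧ adj G b v))
      ≡⟨ degree-split-at G x b ⟨
    degree G b ∎

neighbourDegreeSum-< : (G : Graph n) {a x b : Fin n} (c : ℕ) → degree G a ≡ degree G x →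
                       (∀ v → (adj G a v ∧ not (adj G x v)) ≡ true → degree G v ≤ c) →
                       (∀ v → (adj G x v ∧ not (adj G a v)) ≡ true → c ≤ degree G v) →
                       (adj G x b ∧ not (adj G a b)) ≡ true → c < degree G b →
                       neighbourDegreeSum G a < neighbourDegreeSum G x
neighbourDegreeSum-< G {a} {x} {b} c deg≡ low high b∈ c<b = begin-strict
  neighbourDegreeSum G a               ≡⟨ ∑⟨⟩-split (adj G a) (adj G x) (degree G) ⟩
  Sₐₓ + ∑⟨ onlyA ⟩ (degree G)          ≤⟨ +-monoʳ-≤ Sₐₓ (∑⟨⟩-mono low) ⟩
  Sₐₓ + ∑⟨ onlyA ⟩ (λ _ → c)           ≡⟨ cong₂ _+_ (∑⟨⟩-cong (degree G) λ v → ∧-comm (adj G a v) (adj G x v))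
                                                    (trans (∑⟨⟩-const onlyA c) (cong (c *_) only≡)) ⟩
  Sₓₐ + c * count onlyX                ≡⟨ cong (Sₓₐ +_) (∑⟨⟩-const onlyX c) ⟨
  Sₓₐ + ∑⟨ onlyX ⟩ (λ _ → c)           <⟨ +-monoʳ-< Sₓₐ (∑⟨⟩-mono-< high b b∈ c<b) ⟩
  Sₓₐ + ∑⟨ onlyX ⟩ (degree G)          ≡⟨ ∑⟨⟩-split (adj G x) (adj G a) (degree G) ⟨
  neighbourDegreeSum G x               ∎
  where
  open ≤-Reasoning
  onlyA onlyX : Fin _ → Bool
  onlyA v = adj G a v ∧ not (adj G x v)
  onlyX v = adj G x v ∧ not (adj G a v)
  Sₐₓ Sₓₐ : ℕ
  Sₐₓ = ∑⟨ (λ v → adj G a v ∧ adj G x v) ⟩ (degree G)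
  Sₓₐ = ∑⟨ (λ v → adj G x v ∧ adj G a v) ⟩ (degree G)
  only≡ : count onlyA ≡ count onlyX
  only≡ = +-cancelˡ-≡ (count (λ v → adj G a v ∧ adj G x v)) _ _ (begin-equality
    count (λ v → adj G a v ∧ adj G x v) + count onlyA ≡⟨ count-split (adj G a) (adj G x) ⟨
    degree G a                                        ≡⟨ deg≡ ⟩
    degree G x                                        ≡⟨ count-split (adj G x) (adj G a) ⟩
    count (λ v → adj G x v ∧ adj G a v) + count onlyX ≡⟨ cong (_+ count onlyX) (count-cong λ v → ∧-comm (adj G x v) (adj G a v)) ⟩
    count (λ v → adj G a v ∧ adj G x v) + count onlyX ∎)

-- A value of ThreeCompliant G ⊎ P means that G is 3-compliant or P holds; the
-- left-biased sum monad lets each step assume that no earlier step found a minor.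
module Compliance {n : ℕ} (G : Graph (3 + n)) where

  private
    V : Set
    V = Fin (3 + n)
    variable
      x y z a b c : V

  open Leftbiased (ThreeCompliant G) 0ℓ using (applicative; monad)
  open RawMonad monad using (_<$>_)
  open RawMonad monad public using (_>>=_; pure)

  forAll : {P : V → Set} → (∀ v → ThreeCompliant G ⊎ P v) → ThreeCompliant G ⊎ (∀ v → P v)
  forAll = sequence applicative

  assuming : {Q P : Set} → Dec Q → (Q → ThreeCompliant G ⊎ P) → ThreeCompliant G ⊎ (Q → P)
  assuming (yes q) k = (λ p _ → p) <$> k q
  assuming (no ¬q) _ = pure λ q → contradiction q ¬q

  _~_ _≁_ : V → V → Set
  x ~ y = adj G x y ≡ true
  x ≁ y = adj G x y ≡ false

  _~?_ : (x y : V) → Dec (x ~ y)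
  x ~? y = adj G x y ≟ᵇ true

  ~-sym : x ~ y → y ~ x
  ~-sym {x} {y} xy = trans (symm G y x) xy

  ≁-sym : x ≁ y → y ≁ x
  ≁-sym {x} {y} x≁y = trans (symm G y x) x≁y

  ~-≁-≢ : a ~ b → a ≁ c → b ≢ c
  ~-≁-≢ ab ac refl = contradiction (trans (sym ab) ac) λ ()

  nonNeighbour⁺ : x ≁ a → a ≢ x → nonNeighbour G x a ≡ true
  nonNeighbour⁺ x≁a a≢x rewrite x≁a | ==-false a≢x = refl

  nonNeighbour⁻ : nonNeighbour G x a ≡ true → x ≁ a × a ≢ x
  nonNeighbour⁻ e with ∧-true⁻ e
  ... | x≁a , a≢x = not-true⁻ x≁a , ==-false⁻ (not-true⁻ a≢x)

  ≁⇒adjᶜ : x ≢ y → x ≁ y → adj (complement G) x y ≡ true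
  ≁⇒adjᶜ x≢y x≁y rewrite ==-false x≢y | x≁y = refl

  edgeDominates : x ~ y → (∀ t → t ≢ x → t ≢ y → t ≢ z → x ~ t ⊎ y ~ t) → ThreeCompliant G
  edgeDominates xy dominated = inj₁ (dominatingEdge⇒minor G xy dominated)

  nonEdgeDominates : y ≢ x → x ≁ y → (∀ t → t ≢ x → t ≢ y → t ≢ z → x ≁ t ⊎ y ≁ t) → ThreeCompliant G
  nonEdgeDominates y≢x x≁y dominated = inj₂ (dominatingEdge⇒minor (complement G) (≁⇒adjᶜ (y≢x ∘ sym) x≁y)
    λ t t≢x t≢y t≢z → Data.Sum.map (≁⇒adjᶜ (t≢x ∘ sym)) (≁⇒adjᶜ (t≢y ∘ sym)) (dominated t t≢x t≢y t≢z))

  pathDominates : x ~ y → x ~ z ⊎ y ~ z → z ≢ x → z ≢ y →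
                  (∀ t → t ≢ x → t ≢ y → t ≢ z → x ~ t ⊎ y ~ t ⊎ z ~ t) → ThreeCompliant G
  pathDominates xy xz⊎yz z≢x z≢y dominated = inj₁ (dominatingPath⇒minor G xy xz⊎yz z≢x z≢y dominated)

  nonPathDominates : y ≢ x → x ≁ y → x ≁ z ⊎ y ≁ z → z ≢ x → z ≢ y →
                     (∀ t → t ≢ x → t ≢ y → t ≢ z → x ≁ t ⊎ y ≁ t ⊎ z ≁ t) → ThreeCompliant G
  nonPathDominates y≢x x≁y x≁z⊎y≁z z≢x z≢y dominated = inj₂ (dominatingPath⇒minor (complement G)
    (≁⇒adjᶜ (y≢x ∘ sym) x≁y) (Data.Sum.map (≁⇒adjᶜ (z≢x ∘ sym)) (≁⇒adjᶜ (z≢y ∘ sym)) x≁z⊎y≁z) z≢x z≢y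
    λ t t≢x t≢y t≢z → Data.Sum.map (≁⇒adjᶜ (t≢x ∘ sym))
                        (Data.Sum.map (≁⇒adjᶜ (t≢y ∘ sym)) (≁⇒adjᶜ (t≢z ∘ sym))) (dominated t t≢x t≢y t≢z))

  nonNeighbourMissingBoth : {p q : V} → x ~ p → x ~ q → p ≢ q →
                ThreeCompliant G ⊎ ∃[ a ] (nonNeighbour G x a ≡ true × a ≁ p × a ≁ q)
  nonNeighbourMissingBoth {x} {p} {q} xp xq p≢q
    with any? (λ a → nonNeighbour G x a ≟ᵇ true ×-dec adj G a p ≟ᵇ false ×-dec adj G a q ≟ᵇ false)
  ... | yes found = inj₂ found
  ... | no none = inj₁ (pathDominates xp (inj₁ xq) (adj⇒≢ G xq ∘ sym) (p≢q ∘ sym) dominated)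
    where
    dominated : ∀ t → t ≢ x → t ≢ p → t ≢ q → x ~ t ⊎ p ~ t ⊎ q ~ t
    dominated t t≢x _ _ with adj G x t in xt | adj G t p in tp | adj G t q in tq
    ... | true  | _     | _     = inj₁ refl
    ... | false | true  | _     = inj₂ (inj₁ (~-sym tp))
    ... | false | false | true  = inj₂ (inj₂ (~-sym tq))
    ... | false | false | false = contradiction (t , nonNeighbour⁺ xt t≢x , tp , tq) none

  noCommonNeighbour : ¬ (∃[ u ] (x ~ u × a ~ u × c ~ u)) → ∀ t → x ≁ t ⊎ a ≁ t ⊎ c ≁ t
  noCommonNeighbour {x} {a} {c} none t with adj G x t in xt | adj G a t in at | adj G c t in ct
  ... | false | _     | _     = inj₁ refl
  ... | true  | false | _     = inj₂ (inj₁ refl)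
  ... | true  | true  | false = inj₂ (inj₂ refl)
  ... | true  | true  | true  = contradiction (t , xt , at , ct) none

  commonNeighbour : nonNeighbour G x a ≡ true → c ≢ x → x ≁ c ⊎ a ≁ c →
                    ThreeCompliant G ⊎ ∃[ u ] (x ~ u × a ~ u × c ~ u)
  commonNeighbour {x} {a} {c} a∈A c≢x x≁c⊎a≁c with any? (λ u → x ~? u ×-dec a ~? u ×-dec c ~? u)
  ... | yes found = inj₂ found
  ... | no none with c ≟ a | nonNeighbour⁻ a∈A
  ...   | yes refl | x≁a , a≢x = inj₁ (nonEdgeDominates {z = x} a≢x x≁a λ t _ _ _ →
                                   Data.Sum.map₂ reduce (noCommonNeighbour none t))
  ...   | no c≢a   | x≁a , a≢x = inj₁ (nonPathDominates a≢x x≁a x≁c⊎a≁c c≢x c≢a λ t _ _ _ →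
                                   noCommonNeighbour none t)

  commonNeighbourAvoiding : {p q : V} → x ~ p → x ~ q → p ≢ q → y ≢ x → (x ~ y → y ≡ p ⊎ y ≡ q) →
                            ThreeCompliant G ⊎ ∃[ u ] (x ~ u × y ~ u × u ≢ p × u ≢ q)
  commonNeighbourAvoiding {x} {y} {p} {q} xp xq p≢q y≢x y∈pq = do
    (a , a∈A , a≁p , a≁q) ← nonNeighbourMissingBoth xp xq p≢q
    (u , xu , au , yu) ← commonNeighbour a∈A y≢x (misses a≁p a≁q)
    pure (u , xu , yu , ~-≁-≢ au a≁p , ~-≁-≢ au a≁q)
    where
    misses : a ≁ p → a ≁ q → x ≁ y ⊎ a ≁ y
    misses a≁p a≁q with adj G x y
    ... | false = inj₁ refl
    ... | true with y∈pq refl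
    ...   | inj₁ refl = inj₂ a≁p
    ...   | inj₂ refl = inj₂ a≁q

  commonNeighbours≥3 : 2 ≤ degree G x → nonNeighbour G x a ≡ true →
                      ThreeCompliant G ⊎ 3 ≤ count (λ v → adj G x v ∧ adj G a v)
  commonNeighbours≥3 {x} {a} 2≤deg a∈A = do
    let (p , q , p≢q , xp , xq) = two-distinct {p = adj G x} 2≤deg
    (u₁ , xu₁ , au₁ , u₁≢p , _) ← avoid xp xq p≢q
    (u₂ , xu₂ , au₂ , u₂≢u₁ , _) ← avoid xu₁ xp u₁≢p
    (u₃ , xu₃ , au₃ , u₃≢u₁ , u₃≢u₂) ← avoid xu₁ xu₂ (u₂≢u₁ ∘ sym)
    pure (length≤count {p = λ v → adj G x v ∧ adj G a v} (u₁ ∷ u₂ ∷ u₃ ∷ [])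
            (((u₂≢u₁ ∘ sym) ∷ (u₃≢u₁ ∘ sym) ∷ []) ∷ ((u₃≢u₂ ∘ sym) ∷ []) ∷ [] ∷ [])
            (∧-true xu₁ au₁ ∷ ∧-true xu₂ au₂ ∷ ∧-true xu₃ au₃ ∷ []))
    where
    avoid : {p q : V} → x ~ p → x ~ q → p ≢ q → ThreeCompliant G ⊎ ∃[ u ] (x ~ u × a ~ u × u ≢ p × u ≢ q)
    avoid xp xq p≢q with nonNeighbour⁻ a∈A
    ... | x≁a , a≢x = commonNeighbourAvoiding xp xq p≢q a≢x λ x~a → contradiction (trans (sym x~a) x≁a) λ ()

  commonNeighbours≥2 : 2 ≤ degree G x → x ~ b → ThreeCompliant G ⊎ 2 ≤ count (λ v → adj G x v ∧ adj G b v)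
  commonNeighbours≥2 {x} {b} 2≤deg xb = do
    let (p , xp , b≢p) = otherNeighbour (two-distinct {p = adj G x} 2≤deg)
    (u₁ , xu₁ , bu₁ , _ , _) ← commonNeighbourAvoiding xb xp b≢p b≢x λ _ → inj₁ refl
    (u₂ , xu₂ , bu₂ , _ , u₂≢u₁) ← commonNeighbourAvoiding xb xu₁ (adj⇒≢ G bu₁) b≢x λ _ → inj₁ refl
    pure (length≤count {p = λ v → adj G x v ∧ adj G b v} (u₁ ∷ u₂ ∷ []) (((u₂≢u₁ ∘ sym) ∷ []) ∷ [] ∷ [])
            (∧-true xu₁ bu₁ ∷ ∧-true xu₂ bu₂ ∷ []))
    where
    b≢x : b ≢ x
    b≢x = adj⇒≢ G xb ∘ sym
    otherNeighbour : ∃₂ (λ p q → p ≢ q × x ~ p × x ~ q) → ∃[ p ] (x ~ p × b ≢ p)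
    otherNeighbour (p , q , p≢q , xp , xq) with b ≟ p
    ... | yes refl = q , xq , p≢q
    ... | no b≢p   = p , xp , b≢p

  degree≥5 : 2 ≤ degree G x → ThreeCompliant G ⊎ 5 ≤ degree G x
  degree≥5 {x} 2≤deg = do
    let (p , q , p≢q , xp , xq) = two-distinct {p = adj G x} 2≤deg
    (a , a∈A , a≁p , a≁q) ← nonNeighbourMissingBoth xp xq p≢q
    3≤seen ← commonNeighbours≥3 2≤deg a∈A
    pure (subst (5 ≤_) (sym (count-split (adj G x) (adj G a)))
                (+-mono-≤ 3≤seen (unseen xp xq p≢q a≁p a≁q)))
    where
    unseen : {p q : V} → x ~ p → x ~ q → p ≢ q → a ≁ p → a ≁ q →
             2 ≤ count (λ v → adj G x v ∧ not (adj G a v))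
    unseen {a} {p} {q} xp xq p≢q a≁p a≁q = length≤count {p = λ v → adj G x v ∧ not (adj G a v)}
      (p ∷ q ∷ []) ((p≢q ∷ []) ∷ [] ∷ []) (∧-true xp (cong not a≁p) ∷ ∧-true xq (cong not a≁q) ∷ [])

  degree≥2⇒neighbourDegreeSum≥ : 2 ≤ degree G x → ThreeCompliant G ⊎ 3 * (2 + n) ≤ neighbourDegreeSum G x
  degree≥2⇒neighbourDegreeSum≥ {x} 2≤deg = do
    sees2 ← forAll λ b → assuming (x ~? b) (commonNeighbours≥2 2≤deg)
    sees3 ← forAll λ a → assuming (nonNeighbour G x a ≟ᵇ true) (commonNeighbours≥3 2≤deg)
    pure (neighbourDegreeSum-≥ G x sees2 sees3)

  nonNeighbour-exists : degree G x ≤ 1 → 0 < count (nonNeighbour G x)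
  nonNeighbour-exists {x} deg≤1 = ≤-trans (s≤s z≤n) (s≤s⁻¹ (subst (_≤ 1 + count (nonNeighbour G x))
    (suc-injective (order-split-at G x)) (+-monoˡ-≤ (count (nonNeighbour G x)) deg≤1)))

  degree≤1⇒compliant : degree G x ≤ 1 → ThreeCompliant G
  degree≤1⇒compliant {x} deg≤1 =
    dominate (atMostOne deg≤1 x) (count-witness (nonNeighbour-exists deg≤1))
    where
    dominate : ∃[ z ] (∀ t → x ~ t → t ≡ z) → ∃[ a ] nonNeighbour G x a ≡ true → ThreeCompliant G
    dominate (z , onlyNeighbour) (a , a∈A) =
      nonEdgeDominates {z = z} (proj₂ (nonNeighbour⁻ a∈A)) (proj₁ (nonNeighbour⁻ a∈A)) λ t _ _ t≢z → inj₁ (x≁ t t≢z)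
      where
      x≁ : ∀ t → t ≢ z → x ≁ t
      x≁ t t≢z with adj G x t in xt
      ... | false = refl
      ... | true  = contradiction (onlyNeighbour t xt) t≢z

module _ (G : Graph 15) (edges≤48 : edgeCount G ≤ 48) where

  open Compliance G

  private
    variable
      x : Fin 15

  degreeSum≤96 : ∑[ v < 15 ] degree G v ≤ 96
  degreeSum≤96 = subst (_≤ 96) (sym (handshake G)) (+-mono-≤ edges≤48 edges≤48)

  minimumDegree≤6 : (∀ v → degree G x ≤ degree G v) → degree G x ≤ 6
  minimumDegree≤6 {x} minimal = ≮⇒≥ λ 6<δ →
    from-no (105 ≤? 96) (≤-trans (*-monoʳ-≤ 15 6<δ) (≤-trans (∑-mono minimal) degreeSum≤96))

  degree5⇒compliant : degree G x ≡ 5 → ThreeCompliant G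
  degree5⇒compliant {x} deg≡5 = reduce do
    sees3 ← forAll λ a → assuming (A a ≟ᵇ true) (commonNeighbours≥3 2≤deg)
    missed ← forAll λ p → forAll λ q → assuming (x ~? p ×-dec x ~? q ×-dec ¬? (p ≟ q))
                                         λ { (xp , xq , p≢q) → nonNeighbourMissingBoth xp xq p≢q }
    pure (contradiction (subst₂ (λ d k → d * pred d ≤ 2 * k) deg≡5 nonNeighbours≡9
                           (pairCover-bound (λ a v → not (adj G a v)) (misses≤2 sees3) (covered missed)))
                        (from-no (20 ≤? 18)))
    where
    A : Fin 15 → Bool
    A = nonNeighbour G x
    2≤deg : 2 ≤ degree G x
    2≤deg = subst (2 ≤_) (sym deg≡5) (s≤s (s≤s z≤n))
    nonNeighbours≡9 : count A ≡ 9
    nonNeighbours≡9 = +-cancelˡ-≡ 5 (count A) 9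
      (trans (cong (_+ count A) (sym deg≡5)) (suc-injective (order-split-at G x)))
    misses≤2 : (∀ a → A a ≡ true → 3 ≤ count (λ v → adj G x v ∧ adj G a v)) →
               ∀ a → A a ≡ true → count (λ v → adj G x v ∧ not (adj G a v)) ≤ 2
    misses≤2 sees3 a a∈A = +-cancelˡ-≤ 3 (count (λ v → adj G x v ∧ not (adj G a v))) 2
      (subst (3 + count (λ v → adj G x v ∧ not (adj G a v)) ≤_)
             (trans (sym (count-split (adj G x) (adj G a))) deg≡5)
             (+-monoˡ-≤ (count (λ v → adj G x v ∧ not (adj G a v))) (sees3 a a∈A)))
    covered : (∀ p q → x ~ p × x ~ q × p ≢ q → ∃[ a ] (A a ≡ true × a ≁ p × a ≁ q)) →
              ∀ p q → x ~ p → x ~ q → p ≢ q →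
              ∃[ a ] (A a ≡ true × not (adj G a p) ≡ true × not (adj G a q) ≡ true)
    covered missed p q xp xq p≢q =
      let (a , a∈A , a≁p , a≁q) = missed p q (xp , xq , p≢q) in a , a∈A , cong not a≁p , cong not a≁q

  module MinimumDegree6 {x : Fin 15} (δ≥6 : ∀ v → 6 ≤ degree G v) (deg≡6 : degree G x ≡ 6)
                        (Dx≥42 : 42 ≤ neighbourDegreeSum G x) where

    A : Fin 15 → Bool
    A = nonNeighbour G x

    nonNeighbours≡8 : count A ≡ 8
    nonNeighbours≡8 = +-cancelˡ-≡ 6 (count A) 8
      (trans (cong (_+ count A) (sym deg≡6)) (suc-injective (order-split-at G x)))

    nonNeighbourSum≥48 : 48 ≤ ∑⟨ A ⟩ (degree G)
    nonNeighbourSum≥48 = subst (_≤ ∑⟨ A ⟩ (degree G)) (trans (∑⟨⟩-const A 6) (cong (6 *_) nonNeighbours≡8))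
                           (∑⟨⟩-mono {p = A} λ v _ → δ≥6 v)

    degreeSum-around : neighbourDegreeSum G x + ∑⟨ A ⟩ (degree G) ≤ 90
    degreeSum-around = +-cancelˡ-≤ 6 _ 90
      (subst (_≤ 96) (trans (∑-split-at G x (degree G))
                            (cong (_+ (neighbourDegreeSum G x + ∑⟨ A ⟩ (degree G))) deg≡6)) degreeSum≤96)

    Dx≤42 : neighbourDegreeSum G x ≤ 42
    Dx≤42 = +-cancelʳ-≤ 48 _ 42
      (≤-trans (+-monoʳ-≤ (neighbourDegreeSum G x) nonNeighbourSum≥48) degreeSum-around)

    nonNeighbourSum≤48 : ∑⟨ A ⟩ (degree G) ≤ 48
    nonNeighbourSum≤48 = +-cancelˡ-≤ 42 _ 48 (≤-trans (+-monoˡ-≤ (∑⟨ A ⟩ (degree G)) Dx≥42) degreeSum-around)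

    nonNeighbour-degree : ∀ a → A a ≡ true → degree G a ≡ 6
    nonNeighbour-degree a a∈A = ≤-antisym (≮⇒≥ λ 6<deg → <-irrefl refl (≤-trans
      (∑⟨⟩-mono-< {p = A} (λ v _ → δ≥6 v) a a∈A 6<deg) (≤-trans nonNeighbourSum≤48 (≤-reflexive (sym sum≡)))))
      (δ≥6 a)
      where
      sum≡ : ∑⟨ A ⟩ (λ _ → 6) ≡ 48
      sum≡ = trans (∑⟨⟩-const A 6) (cong (6 *_) nonNeighbours≡8)

    heavyNeighbour : ∃[ b ] (x ~ b × 6 < degree G b)
    heavyNeighbour = decide (any? λ b → x ~? b ×-dec 6 <? degree G b)
      where
      decide : Dec (∃[ b ] (x ~ b × 6 < degree G b)) → ∃[ b ] (x ~ b × 6 < degree G b)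
      decide (yes found) = found
      decide (no none)   = contradiction
        (≤-trans Dx≥42 (≤-trans (∑⟨⟩-mono {p = adj G x} λ b xb → ≮⇒≥ λ 6<b → none (b , xb , 6<b))
                                (≤-reflexive (trans (∑⟨⟩-const (adj G x) 6) (cong (6 *_) deg≡6)))))
        (from-no (42 ≤? 36))

    adjacentToHeavyNeighbour : {b : Fin 15} → x ~ b → 6 < degree G b → ∀ a → A a ≡ true → ThreeCompliant G ⊎ a ~ b
    adjacentToHeavyNeighbour {b} xb 6<b a a∈A with adj G a b in ab
    ... | true  = inj₂ refl
    ... | false = do
      Da≥42 ← degree≥2⇒neighbourDegreeSum≥ (subst (2 ≤_) (sym (nonNeighbour-degree a a∈A)) (s≤s (s≤s z≤n)))
      pure (contradiction (neighbourDegreeSum-< G 6 (trans (nonNeighbour-degree a a∈A) (sym deg≡6)) low high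
                            (∧-true xb (cong not ab)) 6<b)
                          (≤⇒≯ (≤-trans Dx≤42 Da≥42)))
      where
      low : ∀ v → (adj G a v ∧ not (adj G x v)) ≡ true → degree G v ≤ 6
      low v e = let (av , x≁v) = ∧-true⁻ e in ≤-reflexive (nonNeighbour-degree v
        (nonNeighbour⁺ (not-true⁻ x≁v) (~-≁-≢ av (≁-sym (proj₁ (nonNeighbour⁻ a∈A))))))
      high : ∀ v → (adj G x v ∧ not (adj G a v)) ≡ true → 6 ≤ degree G v
      high v _ = δ≥6 v

    compliant : ThreeCompliant G
    compliant = dominate heavyNeighbour
      where
      dominate : ∃[ b ] (x ~ b × 6 < degree G b) → ThreeCompliant G
      dominate (b , xb , 6<b) = reduce do
        seen ← forAll λ a → assuming (A a ≟ᵇ true) (adjacentToHeavyNeighbour xb 6<b a)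
        pure (edgeDominates {z = x} xb λ t t≢x _ _ → dominated seen t t≢x)
        where
        dominated : (∀ a → A a ≡ true → a ~ b) → ∀ t → t ≢ x → x ~ t ⊎ b ~ t
        dominated seen t t≢x with adj G x t in xt
        ... | true  = inj₁ refl
        ... | false = inj₂ (~-sym (seen t (nonNeighbour⁺ xt t≢x)))

  minimumDegree⇒compliant : (∀ v → degree G x ≤ degree G v) → ThreeCompliant G
  minimumDegree⇒compliant {x} minimal = byDegree (2 ≤? degree G x)
    where
    δ≤6 : degree G x ≤ 6
    δ≤6 = minimumDegree≤6 minimal
    fiveOrSix : 5 ≤ degree G x → Dec (degree G x ≡ 5) → ThreeCompliant G
    fiveOrSix _     (yes deg≡5) = degree5⇒compliant deg≡5
    fiveOrSix 5≤deg (no deg≢5)  = reduce do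
      Dx≥42 ← degree≥2⇒neighbourDegreeSum≥ (subst (2 ≤_) (sym deg≡6) (s≤s (s≤s z≤n)))
      pure (MinimumDegree6.compliant (λ v → subst (_≤ degree G v) deg≡6 (minimal v)) deg≡6 Dx≥42)
      where
      deg≡6 : degree G x ≡ 6
      deg≡6 = ≤-antisym δ≤6 (≤∧≢⇒< 5≤deg (deg≢5 ∘ sym))
    byDegree : Dec (2 ≤ degree G x) → ThreeCompliant G
    byDegree (no 2≰deg)  = degree≤1⇒compliant (s≤s⁻¹ (≰⇒> 2≰deg))
    byDegree (yes 2≤deg) = reduce do
      5≤deg ← degree≥5 2≤deg
      pure (fiveOrSix 5≤deg (degree G x ℕ.≟ 5))

lemma15 : (G : Graph 15) → 45 ≤ edgeCount G → edgeCount G ≤ 48 → ThreeCompliant G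
lemma15 G _ edges≤48 = minimumDegree⇒compliant G edges≤48 (proj₂ (minimumDegreeVertex G))
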